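{- Let $G$ be a 2-connected outerplanar near-triangulation with $V(G)=\{u,v_1,\dots,v_{2k}\}$, $N_G(u)=\{v_1,\dots,v_{2k}\}$, $\deg_G(v_1)=\deg_G(v_{2k})=2$, and $v_1,\dots,v_{2k}$ ordered counter-clockwise (consecutively along the outer cycle). Let $1\le l<k$. Then $P(G)$ contains the monomials $\eta\,u^4v_1^0v_{2k}^0v_{2l}^1\prod_{i\notin\{1,2k,2l\}}v_i^2$ and $-\eta\,u^4v_1^0v_{2k}^0v_{2l+1}^1\prod_{i\notin\{1,2k,2l+1\}}v_i^2$, where $|\eta|=1$.
   Context: For a graph $G$, vertices are also variables and $P(G)=\prod_{xy\in E(G),\,x<y}(x-y)$ for a fixed arbitrary orientation; "$P(G)$ contains $\eta M$" means the coefficient of the monomial $M$ in $P(G)$ is $\eta$. A 2-connected outerplanar near-triangulation is a 2-connected outerplanar graph embedded with all vertices on the outer cycle and all bounded faces triangles. -}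

module Defs where

open import Data.Nat as ℕ using (ℕ; zero; suc; _<_; _≡ᵇ_; _∸_)
open import Data.Bool using (Bool; true; false; if_then_else_; _∨_)
open import Data.Fin using (Fin; toℕ; _≟_)
open import Data.Fin.Base using () renaming (zero to fzero)
open import Data.List using (List; []; _∷_; [_]; concatMap; map; foldr; allFin)
open import Data.Vec using (Vec; tabulate; replicate; zipWith)
open import Data.Vec.Properties using (≡-dec)
import Data.Nat.ListAction
open import Data.Integer as ℤ using (ℤ; +_; -_)
open import Data.Product using (_×_; _,_; Σ; ∃)
open import Data.Sum using (_⊎_)
open import Data.Empty using (⊥)
open import Relation.Nullary using (does; ¬_)
open import Relation.Binary.PropositionalEquality using (_≡_)

-- Finite simple graphs on vertex set Fin n (vertices are also variables).

record Graph (n : ℕ) : Set where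
  field
    adj    : Fin n → Fin n → Bool
    sym    : ∀ x y → adj x y ≡ adj y x
    irrefl : ∀ x → adj x x ≡ false
open Graph public

degree : ∀ {n} → Graph n → Fin n → ℕ
degree {n} G x = Data.Nat.ListAction.sum (map (λ y → if adj G x y then 1 else 0) (allFin n))

-- Outerplane embedding with outer (Hamiltonian) cycle 0,1,...,n-1,0
-- given by the vertex labels.

Between : ∀ {n} → Fin n → Fin n → Fin n → Set
Between a c x = (toℕ a < toℕ x) × (toℕ x < toℕ c)

Outside : ∀ {n} → Fin n → Fin n → Fin n → Set
Outside a c x = (toℕ x < toℕ a) ⊎ (toℕ c < toℕ x)

-- the chord bd crosses the chord ac (for toℕ a < toℕ c) in the drawing
-- where vertices lie on a circle in label order
Crosses : ∀ {n} → Fin n → Fin n → Fin n → Fin n → Set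
Crosses a c b d = (Between a c b × Outside a c d) ⊎ (Outside a c b × Between a c d)

record OuterplanarNearTriangulation {n : ℕ} (G : Graph n) : Set where
  field
    atLeast3   : 3 ℕ.≤ n
    -- the outer cycle 0,1,...,n-1,0 is present (this makes G 2-connected)
    cycleStep  : ∀ x y → toℕ y ≡ suc (toℕ x) → adj G x y ≡ true
    cycleClose : ∀ x y → toℕ x ≡ 0 → toℕ y ≡ n ∸ 1 → adj G x y ≡ true
    -- outerplane: all vertices on the outer cycle, no two edges cross
    noCross    : ∀ a c b d → toℕ a < toℕ c → adj G a c ≡ true →
                 adj G b d ≡ true → ¬ Crosses a c b d
    -- all bounded faces are triangles: no further non-crossing chord
    -- can be added (edge-maximality of the outerplane drawing)
    triangulated : ∀ a c → toℕ a < toℕ c → adj G a c ≡ false →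
                   Σ (Fin n) λ b → Σ (Fin n) λ d →
                     (adj G b d ≡ true) × Crosses a c b d

-- Multivariate integer polynomials in variables Fin n, as lists of terms
-- (coefficient, exponent vector); the coefficient of a monomial is the
-- sum of the coefficients of all terms with that exponent vector.

Term : ℕ → Set
Term n = ℤ × Vec ℕ n

Poly : ℕ → Set
Poly n = List (Term n)

unitExp : ∀ {n} → Fin n → Vec ℕ n
unitExp x = tabulate (λ z → if does (z ≟ x) then 1 else 0)

onePoly : ∀ {n} → Poly n
onePoly = [ (+ 1 , replicate _ 0) ]

mulPoly : ∀ {n} → Poly n → Poly n → Poly n
mulPoly p q = concatMap (λ { (a , e) → map (λ { (b , f) → (a ℤ.* b , zipWith ℕ._+_ e f) }) q }) p

diffPoly : ∀ {n} → Fin n → Fin n → Poly n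
diffPoly x y = (+ 1 , unitExp x) ∷ (- (+ 1) , unitExp y) ∷ []

coeff : ∀ {n} → Poly n → Vec ℕ n → ℤ
coeff p M = foldr (λ { (a , e) s → if does (≡-dec ℕ._≟_ e M) then a ℤ.+ s else s }) (+ 0) p

edgeList : ∀ {n} → Graph n → List (Fin n × Fin n)
edgeList {n} G =
  concatMap (λ x → concatMap (λ y →
    if adj G x y Data.Bool.∧ (toℕ x ℕ.<ᵇ toℕ y) then [ (x , y) ] else [])
    (allFin n)) (allFin n)

graphPoly : ∀ {n} → Graph n → Poly n
graphPoly G = foldr (λ { (x , y) acc → mulPoly (diffPoly x y) acc }) onePoly (edgeList G)

-- The monomials of the lemma.  Vertex 0 is u, vertex j (1 ≤ j ≤ 2k) is v_j.

lemmaExp : ℕ → ℕ → ℕ → ℕ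
lemmaExp k m j =
  if j ≡ᵇ 0 then 4
  else if (j ≡ᵇ 1) ∨ (j ≡ᵇ (2 ℕ.* k)) then 0
  else if j ≡ᵇ m then 1
  else 2

lemmaMono : (k m : ℕ) → Vec ℕ (suc (2 ℕ.* k))
lemmaMono k m = tabulate (λ x → lemmaExp k m (toℕ x))

-- The hub u is adjacent to every other vertex, so by outerplanarity G is the fan with spokes u v_i and path
-- v_1 v_2 ⋯ v_{2k}.  Ordering the factors of P(G) as (u − v_1)(v_1 − v_2)(u − v_2)(v_2 − v_3) ⋯ (u − v_{2k}),
-- a coefficient is computed vertex by vertex: once v_i − v_{i+1} is expanded, v_i is gone, and the state is the
-- remaining exponent of u and of v_{i+1}.  A vertex of exponent 2 is entered with remaining exponent 2 or 1, and
-- two consecutive such vertices act as the identity on these two states, so the computation reduces to a fan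
-- with at most five path vertices, where the coefficients of the two monomials are 1 and −1.
module Submission where

open import Defs hiding (sym)
open import Data.Nat using (ℕ; zero; suc; pred; _+_; _*_; _≤_; _<_; _≡ᵇ_; _<ᵇ_; z≤n; s≤s; z<s)
import Data.Nat.Properties as ℕ
open import Data.Nat.Properties using (<⇒≢; >⇒≢; ≤-refl; <-trans; n<1+n; +-suc)
open import Data.Nat.Tactic.RingSolver using () renaming (solve-∀ to ℕ-solve-∀)
open import Data.Integer using (ℤ; -_; ∣_∣; 0ℤ; 1ℤ)
import Data.Integer as ℤ
import Data.Integer.Properties as ℤ
open import Data.Integer.Tactic.RingSolver using (solve-∀)
open import Data.Bool using (Bool; true; false; if_then_else_; _∧_; not)
open import Data.Bool.Properties using (∧-zeroʳ; ∧-identityʳ)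
open import Data.Fin using (Fin; toℕ; fromℕ<) renaming (zero to fzero; suc to fsuc)
open import Data.Fin.Properties using (toℕ<n; toℕ-fromℕ<)
open import Data.List using (List; []; _∷_; _++_; [_]; map; foldr; concat; concatMap; allFin)
import Data.List as List
open import Data.List.Properties using (map-cong; foldr-cong; ++-identityʳ; map-tabulate; map-concatMap; map-++)
open import Data.List.Relation.Binary.Permutation.Propositional using (_↭_; prep; swap)
  renaming (refl to ↭-refl; trans to ↭-trans)
open import Data.List.Relation.Binary.Permutation.Propositional.Properties using (shift)
open import Data.List.Relation.Unary.All using (All; []; _∷_)
open import Data.Vec using (Vec; []; _∷_; lookup; tabulate; zipWith; replicate; _[_]%=_)
open import Data.Vec.Properties using (≡-dec)
open import Data.Product using (Σ; _×_; _,_; proj₁; proj₂)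
open import Data.Sum using (_⊎_; inj₁; inj₂)
open import Data.Empty using (⊥-elim)
open import Function using (_∘_)
open import Relation.Binary using (tri<; tri≈; tri>)
open import Relation.Binary.PropositionalEquality
  using (_≡_; _≢_; _≗_; refl; sym; trans; cong; cong₂; subst; module ≡-Reasoning)
open import Relation.Nullary using (yes; no; does)
open import Relation.Nullary.Decidable using (dec-true; dec-false)

≢⇒≡ᵇ-false : ∀ {m n} → m ≢ n → (m ≡ᵇ n) ≡ false
≢⇒≡ᵇ-false {m} {n} = dec-false (m ℕ.≟ n)

≡⇒≡ᵇ-true : ∀ {m n} → m ≡ n → (m ≡ᵇ n) ≡ true
≡⇒≡ᵇ-true {m} {n} = dec-true (m ℕ.≟ n)

<ᵇ-false : ∀ {m n} → n ≤ m → (m <ᵇ n) ≡ false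
<ᵇ-false {m} {n} n≤m = dec-false (m ℕ.<? n) (ℕ.≤⇒≯ n≤m)

<ᵇ-true : ∀ {m n} → m < n → (m <ᵇ n) ≡ true
<ᵇ-true {m} {n} = dec-true (m ℕ.<? n)

-- Coefficients of products of differences of variables

Exponents : Set
Exponents = ℕ → ℕ

unlessZero : ℕ → ℤ → ℤ
unlessZero zero    _ = 0ℤ
unlessZero (suc _) z = z

lower : ℕ → Exponents → Exponents
lower x g i = if i ≡ᵇ x then pred (g i) else g i

allZero : ℕ → Exponents → Bool
allZero zero    g = true
allZero (suc n) g = (g 0 ≡ᵇ 0) ∧ allZero n (g ∘ suc)

-- The coefficient of ∏_{i<n} X_i^(g i) in ∏_{(x,y) ∈ es} (X_x − X_y), by expansion along the first factor.
diffCoeff : ℕ → List (ℕ × ℕ) → Exponents → ℤ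
diffCoeff n []             g = if allZero n g then 1ℤ else 0ℤ
diffCoeff n ((x , y) ∷ es) g =
  unlessZero (g x) (diffCoeff n es (lower x g)) ℤ.- unlessZero (g y) (diffCoeff n es (lower y g))

allZero-cong : ∀ n {g h} → g ≗ h → allZero n g ≡ allZero n h
allZero-cong zero    g≗h = refl
allZero-cong (suc n) g≗h = cong₂ _∧_ (cong (_≡ᵇ 0) (g≗h 0)) (allZero-cong n (g≗h ∘ suc))

lower-cong : ∀ x {g h} → g ≗ h → lower x g ≗ lower x h
lower-cong x g≗h i with i ≡ᵇ x
... | true  = cong pred (g≗h i)
... | false = g≗h i

diffCoeff-cong : ∀ n es {g h} → g ≗ h → diffCoeff n es g ≡ diffCoeff n es h
diffCoeff-cong n []             g≗h = cong (if_then 1ℤ else 0ℤ) (allZero-cong n g≗h)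
diffCoeff-cong n ((x , y) ∷ es) g≗h =
  cong₂ ℤ._-_ (cong₂ unlessZero (g≗h x) (diffCoeff-cong n es (lower-cong x g≗h)))
              (cong₂ unlessZero (g≗h y) (diffCoeff-cong n es (lower-cong y g≗h)))

lower-self : ∀ x g → lower x g x ≡ pred (g x)
lower-self x g rewrite ≡⇒≡ᵇ-true {x} refl = refl

lower-≢ : ∀ {x i} g → x ≢ i → lower x g i ≡ g i
lower-≢ g x≢i rewrite ≢⇒≡ᵇ-false (x≢i ∘ sym) = refl

lower-comm : ∀ x y g → lower x (lower y g) ≗ lower y (lower x g)
lower-comm x y g i with i ≡ᵇ x | i ≡ᵇ y
... | true  | true  = refl
... | true  | false = refl
... | false | true  = refl
... | false | false = refl

unlessZero-comm : ∀ p q z → unlessZero p (unlessZero q z) ≡ unlessZero q (unlessZero p z)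
unlessZero-comm zero    zero    z = refl
unlessZero-comm zero    (suc q) z = refl
unlessZero-comm (suc p) zero    z = refl
unlessZero-comm (suc p) (suc q) z = refl

unlessZero-zero : ∀ p → unlessZero p 0ℤ ≡ 0ℤ
unlessZero-zero zero    = refl
unlessZero-zero (suc p) = refl

unlessZero-distrib-minus : ∀ p z w → unlessZero p (z ℤ.- w) ≡ unlessZero p z ℤ.- unlessZero p w
unlessZero-distrib-minus zero    z w = refl
unlessZero-distrib-minus (suc p) z w = refl

-- Both orders of lowering reach the same exponent vector, and both pairs of guards test g a and g b.
diffCoeff-lower-lower : ∀ n es a b g →
  unlessZero (g a) (unlessZero (lower a g b) (diffCoeff n es (lower b (lower a g)))) ≡
  unlessZero (g b) (unlessZero (lower b g a) (diffCoeff n es (lower a (lower b g))))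
diffCoeff-lower-lower n es a b g with a ℕ.≟ b
... | yes refl = refl
... | no a≢b
  rewrite lower-≢ g a≢b | lower-≢ g (a≢b ∘ sym)
        | diffCoeff-cong n es (lower-comm b a g)
  = unlessZero-comm (g a) (g b) _

diffCoeff-swap : ∀ n e f es g → diffCoeff n (e ∷ f ∷ es) g ≡ diffCoeff n (f ∷ e ∷ es) g
diffCoeff-swap n (x , y) (z , w) es g = begin
  unlessZero (g x) (Q x z ℤ.- Q x w) ℤ.- unlessZero (g y) (Q y z ℤ.- Q y w)
    ≡⟨ cong₂ ℤ._-_ (unlessZero-distrib-minus (g x) _ _) (unlessZero-distrib-minus (g y) _ _) ⟩
  (R x z ℤ.- R x w) ℤ.- (R y z ℤ.- R y w)
    ≡⟨ exchange (R x z) (R x w) (R y z) (R y w) ⟩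
  (R x z ℤ.- R y z) ℤ.- (R x w ℤ.- R y w)
    ≡⟨ cong₂ ℤ._-_ (cong₂ ℤ._-_ (R-sym x z) (R-sym y z)) (cong₂ ℤ._-_ (R-sym x w) (R-sym y w)) ⟩
  (R z x ℤ.- R z y) ℤ.- (R w x ℤ.- R w y)
    ≡⟨ cong₂ ℤ._-_ (unlessZero-distrib-minus (g z) _ _) (unlessZero-distrib-minus (g w) _ _) ⟨
  unlessZero (g z) (Q z x ℤ.- Q z y) ℤ.- unlessZero (g w) (Q w x ℤ.- Q w y) ∎
  where
  open ≡-Reasoning
  Q : ℕ → ℕ → ℤ
  Q a b = unlessZero (lower a g b) (diffCoeff n es (lower b (lower a g)))
  R : ℕ → ℕ → ℤ
  R a b = unlessZero (g a) (Q a b)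
  R-sym : ∀ a b → R a b ≡ R b a
  R-sym a b = diffCoeff-lower-lower n es a b g
  exchange : ∀ (a b c d : ℤ) → (a ℤ.- b) ℤ.- (c ℤ.- d) ≡ (a ℤ.- c) ℤ.- (b ℤ.- d)
  exchange = solve-∀

diffCoeff-prep : ∀ n e xs ys → (∀ g → diffCoeff n xs g ≡ diffCoeff n ys g) →
                 ∀ g → diffCoeff n (e ∷ xs) g ≡ diffCoeff n (e ∷ ys) g
diffCoeff-prep n (x , y) xs ys eq g = cong₂ ℤ._-_ (cong (unlessZero (g x)) (eq _)) (cong (unlessZero (g y)) (eq _))

diffCoeff-↭ : ∀ n {xs ys} → xs ↭ ys → ∀ g → diffCoeff n xs g ≡ diffCoeff n ys g
diffCoeff-↭ n ↭-refl                 g = refl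
diffCoeff-↭ n (prep {xs} {ys} e p)   g = diffCoeff-prep n e xs ys (diffCoeff-↭ n p) g
diffCoeff-↭ n (swap {xs} {ys} e f p) g =
  trans (diffCoeff-prep n e (f ∷ xs) (f ∷ ys) (diffCoeff-prep n f xs ys (diffCoeff-↭ n p)) g)
        (diffCoeff-swap n e f ys g)
diffCoeff-↭ n (↭-trans p q)          g = trans (diffCoeff-↭ n p g) (diffCoeff-↭ n q g)

allZero-false : ∀ n g {v} → v < n → g v ≢ 0 → allZero n g ≡ false
allZero-false (suc n) g {zero}  _         gv≢0 rewrite ≢⇒≡ᵇ-false gv≢0 = refl
allZero-false (suc n) g {suc v} (s≤s v<n) gv≢0 rewrite allZero-false n (g ∘ suc) v<n gv≢0 = ∧-zeroʳ _

Avoids : ℕ → ℕ × ℕ → Set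
Avoids v (x , y) = x ≢ v × y ≢ v

diffCoeff-absent : ∀ n es g {v} → v < n → All (Avoids v) es → g v ≢ 0 → diffCoeff n es g ≡ 0ℤ
diffCoeff-absent n []             g v<n []                 gv≢0 = cong (if_then 1ℤ else 0ℤ) (allZero-false n g v<n gv≢0)
diffCoeff-absent n ((x , y) ∷ es) g v<n ((x≢v , y≢v) ∷ av) gv≢0
  rewrite diffCoeff-absent n es (lower x g) v<n av (gv≢0 ∘ trans (sym (lower-≢ g x≢v)))
        | diffCoeff-absent n es (lower y g) v<n av (gv≢0 ∘ trans (sym (lower-≢ g y≢v)))
        | unlessZero-zero (g x) | unlessZero-zero (g y) = refl

expOf : ∀ {n} → Vec ℕ n → Exponents
expOf []      _       = 0
expOf (a ∷ M) zero    = a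
expOf (a ∷ M) (suc i) = expOf M i

expOf-lookup : ∀ {n} (M : Vec ℕ n) x → expOf M (toℕ x) ≡ lookup M x
expOf-lookup (a ∷ M) fzero    = refl
expOf-lookup (a ∷ M) (fsuc x) = expOf-lookup M x

expOf-lower : ∀ {n} (M : Vec ℕ n) x → expOf (M [ x ]%= pred) ≗ lower (toℕ x) (expOf M)
expOf-lower (a ∷ M) fzero    zero    = refl
expOf-lower (a ∷ M) fzero    (suc i) = refl
expOf-lower (a ∷ M) (fsuc x) zero    = refl
expOf-lower (a ∷ M) (fsuc x) (suc i) = expOf-lower M x i

expOf-tabulate : ∀ n (f : ℕ → ℕ) {i} → i < n → expOf (tabulate {n = n} (f ∘ toℕ)) i ≡ f i
expOf-tabulate (suc n) f {zero}  _         = refl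
expOf-tabulate (suc n) f {suc i} (s≤s i<n) = expOf-tabulate n (f ∘ suc) i<n

mulVar : ∀ {n} → ℤ → Fin n → Term n → Term n
mulVar s x (b , f) = (s ℤ.* b , f [ x ]%= suc)

zipWith-+-zeros : ∀ {n} (f : Vec ℕ n) → zipWith _+_ (tabulate (λ _ → 0)) f ≡ f
zipWith-+-zeros []      = refl
zipWith-+-zeros (a ∷ f) = cong (a ∷_) (zipWith-+-zeros f)

unitExp-+ : ∀ {n} (x : Fin n) f → zipWith _+_ (unitExp x) f ≡ f [ x ]%= suc
unitExp-+ fzero    (a ∷ f) = cong (suc a ∷_) (zipWith-+-zeros f)
unitExp-+ (fsuc x) (a ∷ f) = cong (a ∷_) (unitExp-+ x f)

mulPoly-diffPoly : ∀ {n} (x y : Fin n) p →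
  mulPoly (diffPoly x y) p ≡ map (mulVar 1ℤ x) p ++ map (mulVar (- 1ℤ) y) p
mulPoly-diffPoly x y p =
  cong₂ _++_ (map-cong (λ { (b , f) → cong (1ℤ ℤ.* b ,_) (unitExp-+ x f) }) p)
             (trans (++-identityʳ _) (map-cong (λ { (b , f) → cong (- 1ℤ ℤ.* b ,_) (unitExp-+ y f) }) p))

coeff-++ : ∀ {n} (p q : Poly n) M → coeff (p ++ q) M ≡ coeff p M ℤ.+ coeff q M
coeff-++ []            q M = sym (ℤ.+-identityˡ _)
coeff-++ ((a , e) ∷ p) q M with does (≡-dec ℕ._≟_ e M)
... | true  = trans (cong (λ t → a ℤ.+ t) (coeff-++ p q M)) (sym (ℤ.+-assoc a _ _))
... | false = coeff-++ p q M

does-≡-raise : ∀ {n} (x : Fin n) f M →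
  does (≡-dec ℕ._≟_ (f [ x ]%= suc) M) ≡ not (lookup M x ≡ᵇ 0) ∧ does (≡-dec ℕ._≟_ f (M [ x ]%= pred))
does-≡-raise fzero    (a ∷ f) (zero  ∷ M) = refl
does-≡-raise fzero    (a ∷ f) (suc m ∷ M) = refl
does-≡-raise (fsuc x) (a ∷ f) (m ∷ M) rewrite does-≡-raise x f M =
  ∧-exchange (a ≡ᵇ m) (not (lookup M x ≡ᵇ 0)) (does (≡-dec ℕ._≟_ f (M [ x ]%= pred)))
  where
  ∧-exchange : ∀ p q r → p ∧ (q ∧ r) ≡ q ∧ (p ∧ r)
  ∧-exchange true  q r = refl
  ∧-exchange false q r = sym (∧-zeroʳ q)

coeff-map-mulVar : ∀ {n} s (x : Fin n) p M →
  coeff (map (mulVar s x) p) M ≡ s ℤ.* unlessZero (lookup M x) (coeff p (M [ x ]%= pred))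
coeff-map-mulVar s x [] M = sym (trans (cong (s ℤ.*_) (unlessZero-zero (lookup M x))) (ℤ.*-zeroʳ s))
coeff-map-mulVar s x ((b , f) ∷ p) M =
  trans (cong₂ (λ d r → if d then s ℤ.* b ℤ.+ r else r) (does-≡-raise x f M) (coeff-map-mulVar s x p M))
        (guard (lookup M x) (does (≡-dec ℕ._≟_ f (M [ x ]%= pred))))
  where
  c : ℤ
  c = coeff p (M [ x ]%= pred)
  guard : ∀ m d → (if not (m ≡ᵇ 0) ∧ d then s ℤ.* b ℤ.+ s ℤ.* unlessZero m c else s ℤ.* unlessZero m c)
                  ≡ s ℤ.* unlessZero m (if d then b ℤ.+ c else c)
  guard zero    d     = refl
  guard (suc m) true  = sym (ℤ.*-distribˡ-+ s b c)
  guard (suc m) false = refl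

coeff-onePoly : ∀ {n} (M : Vec ℕ n) → coeff onePoly M ≡ (if allZero n (expOf M) then 1ℤ else 0ℤ)
coeff-onePoly {n} M = cong (if_then 1ℤ else 0ℤ) (does-zeros M)
  where
  does-zeros : ∀ {n} (M : Vec ℕ n) → does (≡-dec ℕ._≟_ (replicate n 0) M) ≡ allZero n (expOf M)
  does-zeros []          = refl
  does-zeros (zero  ∷ M) = does-zeros M
  does-zeros (suc m ∷ M) = refl

diffProduct : ∀ {n} → List (Fin n × Fin n) → Poly n
diffProduct = foldr (λ e → mulPoly (diffPoly (proj₁ e) (proj₂ e))) onePoly

graphPoly-diffProduct : ∀ {n} (G : Graph n) → graphPoly G ≡ diffProduct (edgeList G)
graphPoly-diffProduct G = foldr-cong (λ { (x , y) p → refl }) refl (edgeList G)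

toℕ² : ∀ {n} → Fin n × Fin n → ℕ × ℕ
toℕ² (x , y) = (toℕ x , toℕ y)

coeff-diffProduct : ∀ {n} es (M : Vec ℕ n) → coeff (diffProduct es) M ≡ diffCoeff n (map toℕ² es) (expOf M)
coeff-diffProduct []            M = coeff-onePoly M
coeff-diffProduct {n} ((x , y) ∷ es) M = begin
  coeff (mulPoly (diffPoly x y) p) M
    ≡⟨ cong (λ q → coeff q M) (mulPoly-diffPoly x y p) ⟩
  coeff (map (mulVar 1ℤ x) p ++ map (mulVar (- 1ℤ) y) p) M
    ≡⟨ coeff-++ (map (mulVar 1ℤ x) p) _ M ⟩
  coeff (map (mulVar 1ℤ x) p) M ℤ.+ coeff (map (mulVar (- 1ℤ) y) p) M
    ≡⟨ cong₂ ℤ._+_ (coeff-map-mulVar 1ℤ x p M) (coeff-map-mulVar (- 1ℤ) y p M) ⟩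
  1ℤ ℤ.* lowerAt x ℤ.+ (- 1ℤ) ℤ.* lowerAt y
    ≡⟨ signs (lowerAt x) (lowerAt y) ⟩
  lowerAt x ℤ.- lowerAt y
    ≡⟨ cong₂ ℤ._-_ (step x) (step y) ⟩
  diffCoeff n (map toℕ² ((x , y) ∷ es)) (expOf M) ∎
  where
  open ≡-Reasoning
  p : Poly n
  p = diffProduct es
  lowerAt : Fin n → ℤ
  lowerAt z = unlessZero (lookup M z) (coeff p (M [ z ]%= pred))
  signs : ∀ a b → 1ℤ ℤ.* a ℤ.+ (- 1ℤ) ℤ.* b ≡ a ℤ.- b
  signs = solve-∀
  step : ∀ z → lowerAt z ≡ unlessZero (expOf M (toℕ z)) (diffCoeff n (map toℕ² es) (lower (toℕ z) (expOf M)))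
  step z = cong₂ unlessZero (sym (expOf-lookup M z))
             (trans (coeff-diffProduct es (M [ z ]%= pred)) (diffCoeff-cong n (map toℕ² es) (expOf-lower M z)))

-- The edges of a fan

interval : ℕ → ℕ → List ℕ
interval s zero    = []
interval s (suc m) = s ∷ interval (suc s) m

interval-++ : ∀ s k₁ k₂ → interval s (k₁ + k₂) ≡ interval s k₁ ++ interval (s + k₁) k₂
interval-++ s zero     k₂ = cong (λ t → interval t k₂) (sym (ℕ.+-identityʳ s))
interval-++ s (suc k₁) k₂ =
  cong (s ∷_) (trans (interval-++ (suc s) k₁ k₂) (cong (λ t → interval (suc s) k₁ ++ interval t k₂) (sym (+-suc s k₁))))

map-interval-cong : ∀ {f g : ℕ → ℕ} s k → (∀ i → s ≤ i → i < s + k → f i ≡ g i) →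
                    map f (interval s k) ≡ map g (interval s k)
map-interval-cong s zero    f≡g = refl
map-interval-cong s (suc k) f≡g =
  cong₂ _∷_ (f≡g s ≤-refl (ℕ.m<m+n s z<s))
            (map-interval-cong (suc s) k (λ i s<i i<s+k → f≡g i (ℕ.<⇒≤ s<i) (subst (i <_) (sym (+-suc s k)) i<s+k)))

map-interval-const : ∀ {f : ℕ → ℕ} c s k → (∀ i → s ≤ i → i < s + k → f i ≡ c) →
                     map f (interval s k) ≡ List.replicate k c
map-interval-const c s zero    f≡c = refl
map-interval-const c s (suc k) f≡c =
  cong₂ _∷_ (f≡c s ≤-refl (ℕ.m<m+n s z<s))
            (map-interval-const c (suc s) k (λ i s<i i<s+k → f≡c i (ℕ.<⇒≤ s<i) (subst (i <_) (sym (+-suc s k)) i<s+k)))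

tabulate-interval : ∀ {A : Set} n s (f : Fin n → A) (F : ℕ → A) →
  (∀ i → f i ≡ F (s + toℕ i)) → List.tabulate f ≡ map F (interval s n)
tabulate-interval zero    s f F f≡F = refl
tabulate-interval (suc n) s f F f≡F =
  cong₂ _∷_ (trans (f≡F fzero) (cong F (ℕ.+-identityʳ s)))
            (tabulate-interval n (suc s) (f ∘ fsuc) F (λ i → trans (f≡F (fsuc i)) (cong F (+-suc s (toℕ i)))))

concatMap-allFin : ∀ {A : Set} n (f : Fin n → List A) (F : ℕ → List A) →
  (∀ x → f x ≡ F (toℕ x)) → concatMap f (allFin n) ≡ concatMap F (interval 0 n)
concatMap-allFin n f F f≡F = cong concat (trans (map-tabulate (λ x → x) f) (tabulate-interval n 0 f F f≡F))

pairsWhere : (ℕ → ℕ → Bool) → ℕ → List (ℕ × ℕ)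
pairsWhere R n = concatMap (λ a → concatMap (λ b → if R a b then [ (a , b) ] else []) (interval 0 n)) (interval 0 n)

edgeList-pairsWhere : ∀ {n} (G : Graph n) (R : ℕ → ℕ → Bool) →
  (∀ x y → (adj G x y ∧ (toℕ x <ᵇ toℕ y)) ≡ R (toℕ x) (toℕ y)) →
  map toℕ² (edgeList G) ≡ pairsWhere R n
edgeList-pairsWhere {n} G R adj≡R =
  trans (map-concatMap toℕ² _ (allFin n)) (concatMap-allFin n _ _ row)
  where
  entry : ∀ x y → map toℕ² (if adj G x y ∧ (toℕ x <ᵇ toℕ y) then [ (x , y) ] else [])
                  ≡ (if R (toℕ x) (toℕ y) then [ (toℕ x , toℕ y) ] else [])
  entry x y rewrite adj≡R x y with R (toℕ x) (toℕ y)
  ... | true  = refl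
  ... | false = refl
  row : ∀ x → map toℕ² (concatMap (λ y → if adj G x y ∧ (toℕ x <ᵇ toℕ y) then [ (x , y) ] else []) (allFin n))
              ≡ concatMap (λ b → if R (toℕ x) b then [ (toℕ x , b) ] else []) (interval 0 n)
  row x = trans (map-concatMap toℕ² _ (allFin n)) (concatMap-allFin n _ _ (entry x))

select : ℕ → ℕ → List ℕ → List (ℕ × ℕ)
select a t = concatMap (λ b → if b ≡ᵇ t then [ (a , b) ] else [])

select-above : ∀ a t s k → t < s → select a t (interval s k) ≡ []
select-above a t s zero    t<s = refl
select-above a t s (suc k) t<s rewrite ≢⇒≡ᵇ-false (>⇒≢ t<s) =
  select-above a t (suc s) k (<-trans t<s (n<1+n s))

select-below : ∀ a t s k → s + k ≤ t → select a t (interval s k) ≡ []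
select-below a t s zero    _      = refl
select-below a t s (suc k) s+k<t
  rewrite ≢⇒≡ᵇ-false (<⇒≢ (ℕ.<-≤-trans (ℕ.m<m+n s z<s) s+k<t))
  = select-below a t (suc s) k (subst (_≤ t) (+-suc s k) s+k<t)

select-hit : ∀ a t s k → s ≤ t → t < s + k → select a t (interval s k) ≡ [ (a , t) ]
select-hit a t s zero    s≤t t<s+0 = ⊥-elim (ℕ.<⇒≱ (subst (t <_) (ℕ.+-identityʳ s) t<s+0) s≤t)
select-hit a t s (suc k) s≤t t<s+k with ℕ.m≤n⇒m<n∨m≡n s≤t
... | inj₂ refl rewrite ≡⇒≡ᵇ-true {s} refl = cong ((a , s) ∷_) (select-above a s (suc s) k (n<1+n s))
... | inj₁ s<t  rewrite ≢⇒≡ᵇ-false (<⇒≢ s<t) =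
  select-hit a t (suc s) k s<t (subst (t <_) (+-suc s k) t<s+k)

fanEdgeᵇ : ℕ → ℕ → Bool
fanEdgeᵇ zero    b = 0 <ᵇ b
fanEdgeᵇ (suc a) b = b ≡ᵇ suc (suc a)

module _ {n} (G : Graph n) (ont : OuterplanarNearTriangulation G)
         (hub : ∀ x y → toℕ x ≡ 0 → toℕ y ≢ 0 → adj G x y ≡ true) where

  open OuterplanarNearTriangulation ont

  -- Such a chord would cross the spoke from the hub to the vertex x + 1.
  long-chord-absent : ∀ x y → 1 ≤ toℕ x → suc (toℕ x) < toℕ y → adj G x y ≡ false
  long-chord-absent x y 1≤x x+1<y with adj G x y in x~y
  ... | false = refl
  ... | true  = ⊥-elim (noCross x y mid u x<y x~y mid~u (inj₁ ((x<mid , mid<y) , inj₁ u<x)))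
    where
    mid<n : suc (toℕ x) < n
    mid<n = <-trans x+1<y (toℕ<n y)
    mid : Fin n
    mid = fromℕ< mid<n
    u : Fin n
    u = fromℕ< (<-trans z<s mid<n)
    x<mid : toℕ x < toℕ mid
    x<mid = subst (toℕ x <_) (sym (toℕ-fromℕ< mid<n)) ≤-refl
    mid<y : toℕ mid < toℕ y
    mid<y = subst (_< toℕ y) (sym (toℕ-fromℕ< mid<n)) x+1<y
    u<x : toℕ u < toℕ x
    u<x = subst (_< toℕ x) (sym (toℕ-fromℕ< (<-trans z<s mid<n))) 1≤x
    x<y : toℕ x < toℕ y
    x<y = <-trans x<mid mid<y
    mid~u : adj G mid u ≡ true
    mid~u = trans (Graph.sym G mid u)
                  (hub u mid (toℕ-fromℕ< _) (λ mid≡0 → <⇒≢ (ℕ.<-≤-trans z<s x<mid) (sym mid≡0)))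

  fan-adj : ∀ x y → (adj G x y ∧ (toℕ x <ᵇ toℕ y)) ≡ fanEdgeᵇ (toℕ x) (toℕ y)
  fan-adj x y with toℕ x in x≡a
  ... | zero with toℕ y in y≡b
  ...   | zero  = ∧-zeroʳ _
  ...   | suc b rewrite hub x y x≡a (λ y≡0 → ℕ.0≢1+n (trans (sym y≡0) y≡b)) = refl
  fan-adj x y | suc a with ℕ.<-cmp (toℕ y) (suc (suc a))
  ... | tri< y<a+2 _ _
    rewrite <ᵇ-false (ℕ.≤-pred y<a+2) | ≢⇒≡ᵇ-false (<⇒≢ y<a+2) = ∧-zeroʳ _
  ... | tri≈ _ y≡a+2 _
    rewrite cycleStep x y (trans y≡a+2 (cong suc (sym x≡a))) | y≡a+2
          | <ᵇ-true (n<1+n (suc a)) | ≡⇒≡ᵇ-true {suc a} refl = refl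
  ... | tri> _ _ a+2<y
    rewrite ≢⇒≡ᵇ-false (>⇒≢ a+2<y)
          | long-chord-absent x y (subst (1 ≤_) (sym x≡a) (s≤s z≤n))
                                (subst (λ t → suc t < toℕ y) (sym x≡a) a+2<y)
    = refl

spoke : ℕ → ℕ × ℕ
spoke i = (0 , i)

spokes : ℕ → ℕ → List (ℕ × ℕ)
spokes j m = map spoke (interval j (suc m))

rim : ℕ → ℕ → List (ℕ × ℕ)
rim j m = map (λ i → (i , suc i)) (interval j m)

fanOrder : ℕ → ℕ → List (ℕ × ℕ)
fanOrder j zero    = [ (0 , j) ]
fanOrder j (suc m) = (0 , j) ∷ (j , suc j) ∷ fanOrder (suc j) m

spokes++rim↭fanOrder : ∀ j m → spokes j m ++ rim j m ↭ fanOrder j m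
spokes++rim↭fanOrder j zero    = ↭-refl
spokes++rim↭fanOrder j (suc m) =
  prep (0 , j) (↭-trans (shift (j , suc j) (spokes (suc j) m) (rim (suc j) m))
                        (prep (j , suc j) (spokes++rim↭fanOrder (suc j) m)))

pairsWhere-fan : ∀ m → pairsWhere fanEdgeᵇ (2 + m) ≡ spokes 1 m ++ rim 1 m
pairsWhere-fan m = cong₂ _++_ (hub-row 0 (suc m)) (rim-rows 0 m refl)
  where
  hub-row : ∀ s k → concatMap (λ b → if 0 <ᵇ b then [ (0 , b) ] else []) (interval (suc s) k)
                    ≡ map spoke (interval (suc s) k)
  hub-row s zero    = refl
  hub-row s (suc k) = cong ((0 , suc s) ∷_) (hub-row (suc s) k)
  rim-rows : ∀ s k → suc s + k ≡ suc m →
    concatMap (λ a → concatMap (λ b → if fanEdgeᵇ a b then [ (a , b) ] else []) (interval 0 (2 + m)))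
              (interval (suc s) (suc k))
    ≡ rim (suc s) k
  rim-rows s zero    s+0≡m =
    cong (_++ []) (select-below (suc s) (2 + s) 0 (2 + m)
                    (subst (λ t → 2 + m ≤ 2 + t) s≡m ≤-refl))
    where
    s≡m : m ≡ s
    s≡m = ℕ.suc-injective (trans (sym s+0≡m) (cong suc (ℕ.+-identityʳ s)))
  rim-rows s (suc k) s+k≡m =
    cong₂ _++_ (select-hit (suc s) (2 + s) 0 (2 + m) z≤n (s≤s (s≤s s<m)))
               (rim-rows (suc s) k (trans (sym (+-suc (suc s) k)) s+k≡m))
    where
    s<m : s < m
    s<m = subst (s <_) (ℕ.suc-injective s+k≡m) (ℕ.m<m+n s z<s)

-- Expanding the product of a fan vertex by vertex

exhausted : ℕ → ℤ → ℤ
exhausted zero    z = z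
exhausted (suc _) _ = 0ℤ

-- fanCoeff r c es is the coefficient of u^r v^c w₁^e₁ w₂^e₂ ⋯ in (u − v)(v − w₁)(u − w₁)(w₁ − w₂) ⋯ (u − w_last),
-- where es = e₁ e₂ ⋯; after the factor v − w₁ the variable v no longer occurs, so its exponent must be used up.
fanCoeff : ℕ → ℕ → List ℕ → ℤ
fanCoeff r c [] =
  unlessZero r (exhausted (pred r) (exhausted c 1ℤ)) ℤ.- unlessZero c (exhausted r (exhausted (pred c) 1ℤ))
fanCoeff r c (a ∷ as) =
  unlessZero r (unlessZero c (exhausted (pred c) (fanCoeff (pred r) a as))
                ℤ.- unlessZero a (exhausted c (fanCoeff (pred r) (pred a) as)))
  ℤ.- unlessZero c (unlessZero (pred c) (exhausted (pred (pred c)) (fanCoeff r a as))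
                    ℤ.- unlessZero a (exhausted (pred c) (fanCoeff r (pred a) as)))

VanishBetween : ℕ → Exponents → Set
VanishBetween j g = ∀ i → 1 ≤ i → i < j → g i ≡ 0

VanishBetween-lower : ∀ {j g} x → x ≡ 0 ⊎ j ≤ x → VanishBetween j g → VanishBetween j (lower x g)
VanishBetween-lower {j} {g} x x-out g≡0 i 1≤i i<j = trans (lower-≢ g (x≢i x-out)) (g≡0 i 1≤i i<j)
  where
  x≢i : x ≡ 0 ⊎ j ≤ x → x ≢ i
  x≢i (inj₁ refl) = <⇒≢ 1≤i
  x≢i (inj₂ j≤x)  = >⇒≢ (ℕ.<-≤-trans i<j j≤x)

allZero-hub-last : ∀ j h → VanishBetween (suc j) h → allZero (2 + j) h ≡ (h 0 ≡ᵇ 0) ∧ (h (suc j) ≡ᵇ 0)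
allZero-hub-last j h h≡0 = cong ((h 0 ≡ᵇ 0) ∧_) (last j (h ∘ suc) (λ i i<j → h≡0 (suc i) (s≤s z≤n) (s≤s i<j)))
  where
  last : ∀ j h → (∀ i → i < j → h i ≡ 0) → allZero (suc j) h ≡ (h j ≡ᵇ 0)
  last zero    h _    = ∧-identityʳ _
  last (suc j) h h≡0 rewrite h≡0 0 (s≤s z≤n) = last j (h ∘ suc) (λ i i<j → h≡0 (suc i) (s≤s i<j))

indicator-exhausted : ∀ a b → (if (a ≡ᵇ 0) ∧ (b ≡ᵇ 0) then 1ℤ else 0ℤ) ≡ exhausted a (exhausted b 1ℤ)
indicator-exhausted zero    zero    = refl
indicator-exhausted zero    (suc b) = refl
indicator-exhausted (suc a) b       = refl

map-lower-beyond : ∀ x g s k → x < s → map (lower x g) (interval s k) ≡ map g (interval s k)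
map-lower-beyond x g s zero    x<s = refl
map-lower-beyond x g s (suc k) x<s =
  cong₂ _∷_ (lower-≢ g (<⇒≢ x<s)) (map-lower-beyond x g (suc s) k (<-trans x<s (n<1+n s)))

fanOrder-avoids : ∀ {v} j m → 1 ≤ v → v < j → All (Avoids v) (fanOrder j m)
fanOrder-avoids j zero    1≤v v<j = (<⇒≢ 1≤v , >⇒≢ v<j) ∷ []
fanOrder-avoids {v} j (suc m) 1≤v v<j =
  (<⇒≢ 1≤v , >⇒≢ v<j) ∷ (>⇒≢ v<j , >⇒≢ v<j+1) ∷ fanOrder-avoids (suc j) m 1≤v v<j+1
  where
  v<j+1 : v < suc j
  v<j+1 = <-trans v<j (n<1+n j)

diffCoeff-lastSpoke : ∀ j g → VanishBetween (suc j) g →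
  diffCoeff (2 + j) [ (0 , suc j) ] g ≡ fanCoeff (g 0) (g (suc j)) []
diffCoeff-lastSpoke j g g≡0 = cong₂ ℤ._-_ (cong (unlessZero (g 0)) take-u) (cong (unlessZero (g (suc j))) take-v)
  where
  take-u : (if allZero (2 + j) (lower 0 g) then 1ℤ else 0ℤ) ≡ exhausted (pred (g 0)) (exhausted (g (suc j)) 1ℤ)
  take-u = trans (cong (if_then 1ℤ else 0ℤ) (allZero-hub-last j (lower 0 g) (VanishBetween-lower 0 (inj₁ refl) g≡0)))
                 (indicator-exhausted (pred (g 0)) (g (suc j)))
  take-v : (if allZero (2 + j) (lower (suc j) g) then 1ℤ else 0ℤ) ≡ exhausted (g 0) (exhausted (pred (g (suc j))) 1ℤ)
  take-v = trans (cong (if_then 1ℤ else 0ℤ) (allZero-hub-last j (lower (suc j) g) (VanishBetween-lower (suc j) (inj₂ ≤-refl) g≡0)))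
                 (trans (cong (λ b → if (g 0 ≡ᵇ 0) ∧ (b ≡ᵇ 0) then 1ℤ else 0ℤ) (lower-self (suc j) g))
                        (indicator-exhausted (g 0) (pred (g (suc j)))))

diffCoeff-fanOrder : ∀ n j m g → 1 ≤ j → VanishBetween j g → n ≡ suc (m + j) →
  diffCoeff n (fanOrder j m) g ≡ fanCoeff (g 0) (g j) (map g (interval (suc j) m))
diffCoeff-fanOrder n (suc j) zero g _ g≡0 refl = diffCoeff-lastSpoke j g g≡0
diffCoeff-fanOrder n j@(suc _) (suc m) g _ g≡0 n≡ =
  cong₂ ℤ._-_
    (cong (unlessZero (g 0)) (cong₂ ℤ._-_ (cong (unlessZero (g j)) uv) (cong (unlessZero (g (suc j))) uw)))
    (cong (unlessZero (g j)) (cong₂ ℤ._-_ (cong₂ unlessZero (lower-self j g) vv) (cong₂ unlessZero (lower-≢ g j≢j+1) vw)))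
  where
  j≢j+1 : j ≢ suc j
  j≢j+1 = <⇒≢ (n<1+n j)
  j<2+j : j < 2 + j
  j<2+j = <-trans (n<1+n j) (n<1+n (suc j))
  j<n : j < n
  j<n = subst (j <_) (sym n≡) (s≤s (ℕ.m≤n+m j (suc m)))
  R : List ℕ
  R = map g (interval (2 + j) m)
  next : ∀ h → VanishBetween j h →
    diffCoeff n (fanOrder (suc j) m) h ≡ exhausted (h j) (fanCoeff (h 0) (h (suc j)) (map h (interval (2 + j) m)))
  next h h≡0 with h j in hj≡
  ... | zero  = diffCoeff-fanOrder n (suc j) m h (s≤s z≤n) h≡0′ (trans n≡ (cong suc (sym (+-suc m j))))
    where
    h≡0′ : VanishBetween (suc j) h
    h≡0′ i 1≤i i≤j with ℕ.m≤n⇒m<n∨m≡n (ℕ.≤-pred i≤j)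
    ... | inj₁ i<j  = h≡0 i 1≤i i<j
    ... | inj₂ refl = hj≡
  ... | suc _ = diffCoeff-absent n (fanOrder (suc j) m) h j<n (fanOrder-avoids (suc j) m (s≤s z≤n) (n<1+n j))
                                 (λ hj≡0 → ℕ.0≢1+n (trans (sym hj≡0) hj≡))
  resume : ∀ x y {c r a} → x ≡ 0 ⊎ j ≤ x → y ≡ 0 ⊎ j ≤ y → x < 2 + j → y < 2 + j →
           let h = lower y (lower x g) in h j ≡ c → h 0 ≡ r → h (suc j) ≡ a →
           diffCoeff n (fanOrder (suc j) m) h ≡ exhausted c (fanCoeff r a R)
  resume x y x-out y-out x< y< refl refl refl =
    trans (next _ (VanishBetween-lower y y-out (VanishBetween-lower x x-out g≡0)))
          (cong (λ A → exhausted _ (fanCoeff _ _ A))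
                (trans (map-lower-beyond y _ (2 + j) m y<) (map-lower-beyond x g (2 + j) m x<)))
  uv : diffCoeff n (fanOrder (suc j) m) (lower j (lower 0 g)) ≡ exhausted (pred (g j)) (fanCoeff (pred (g 0)) (g (suc j)) R)
  uv = resume 0 j (inj₁ refl) (inj₂ ≤-refl) z<s j<2+j
              (lower-self j (lower 0 g)) refl (lower-≢ (lower 0 g) j≢j+1)
  uw : diffCoeff n (fanOrder (suc j) m) (lower (suc j) (lower 0 g)) ≡ exhausted (g j) (fanCoeff (pred (g 0)) (pred (g (suc j))) R)
  uw = resume 0 (suc j) (inj₁ refl) (inj₂ (ℕ.n≤1+n j)) z<s (n<1+n (suc j))
              (lower-≢ (lower 0 g) (j≢j+1 ∘ sym)) refl (lower-self (suc j) (lower 0 g))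
  vv : diffCoeff n (fanOrder (suc j) m) (lower j (lower j g)) ≡ exhausted (pred (pred (g j))) (fanCoeff (g 0) (g (suc j)) R)
  vv = resume j j (inj₂ ≤-refl) (inj₂ ≤-refl) j<2+j j<2+j
              (trans (lower-self j (lower j g)) (cong pred (lower-self j g))) refl
              (trans (lower-≢ (lower j g) j≢j+1) (lower-≢ g j≢j+1))
  vw : diffCoeff n (fanOrder (suc j) m) (lower (suc j) (lower j g)) ≡ exhausted (pred (g j)) (fanCoeff (g 0) (pred (g (suc j))) R)
  vw = resume j (suc j) (inj₂ ≤-refl) (inj₂ (ℕ.n≤1+n j)) j<2+j (n<1+n (suc j))
              (trans (lower-≢ (lower j g) (j≢j+1 ∘ sym)) (lower-self j g)) refl
              (trans (lower-self (suc j) (lower j g)) (cong pred (lower-≢ g j≢j+1)))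

record _≈_ (X Y : List ℕ) : Set where
  field fanCoeff-≡ : ∀ r c → fanCoeff r c X ≡ fanCoeff r c Y
open _≈_

record _≈₁₂_ (X Y : List ℕ) : Set where
  field
    fanCoeff-1-≡ : ∀ r → fanCoeff r 1 X ≡ fanCoeff r 1 Y
    fanCoeff-2-≡ : ∀ r → fanCoeff r 2 X ≡ fanCoeff r 2 Y
open _≈₁₂_

≈-refl : ∀ {X} → X ≈ X
≈-refl .fanCoeff-≡ r c = refl

≈₁₂-trans : ∀ {X Y Z} → X ≈₁₂ Y → Y ≈₁₂ Z → X ≈₁₂ Z
≈₁₂-trans X≈Y Y≈Z .fanCoeff-1-≡ r = trans (fanCoeff-1-≡ X≈Y r) (fanCoeff-1-≡ Y≈Z r)
≈₁₂-trans X≈Y Y≈Z .fanCoeff-2-≡ r = trans (fanCoeff-2-≡ X≈Y r) (fanCoeff-2-≡ Y≈Z r)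

≈⇒≈₁₂ : ∀ {X Y} → X ≈ Y → X ≈₁₂ Y
≈⇒≈₁₂ X≈Y .fanCoeff-1-≡ r = fanCoeff-≡ X≈Y r 1
≈⇒≈₁₂ X≈Y .fanCoeff-2-≡ r = fanCoeff-≡ X≈Y r 2

∷-≈ : ∀ a {X Y} → X ≈ Y → (a ∷ X) ≈ (a ∷ Y)
∷-≈ a X≈Y .fanCoeff-≡ r c =
  cong₂ ℤ._-_
    (cong (unlessZero r) (cong₂ ℤ._-_ (cong (unlessZero c ∘ exhausted (pred c)) (fanCoeff-≡ X≈Y _ _))
                                      (cong (unlessZero a ∘ exhausted c) (fanCoeff-≡ X≈Y _ _))))
    (cong (unlessZero c) (cong₂ ℤ._-_ (cong (unlessZero (pred c) ∘ exhausted (pred (pred c))) (fanCoeff-≡ X≈Y _ _))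
                                      (cong (unlessZero a ∘ exhausted (pred c)) (fanCoeff-≡ X≈Y _ _))))

-- fanCoeff r c (2 ∷ X) consults X only through fanCoeff _ 2 X and fanCoeff _ 1 X.
2∷-≈ : ∀ {X Y} → X ≈₁₂ Y → (2 ∷ X) ≈ (2 ∷ Y)
2∷-≈ X≈Y .fanCoeff-≡ r c =
  cong₂ ℤ._-_
    (cong (unlessZero r) (cong₂ ℤ._-_ (cong (unlessZero c ∘ exhausted (pred c)) (fanCoeff-2-≡ X≈Y _))
                                      (cong (unlessZero 2 ∘ exhausted c) (fanCoeff-1-≡ X≈Y _))))
    (cong (unlessZero c) (cong₂ ℤ._-_ (cong (unlessZero (pred c) ∘ exhausted (pred (pred c))) (fanCoeff-2-≡ X≈Y _))
                                      (cong (unlessZero 2 ∘ exhausted (pred c)) (fanCoeff-1-≡ X≈Y _))))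

fanCoeff-2-2∷ : ∀ r W → fanCoeff r 2 (2 ∷ W) ≡ ℤ.- fanCoeff r 2 W
fanCoeff-2-2∷ zero    W = minus (fanCoeff 0 2 W)
  where
  minus : ∀ x → 0ℤ ℤ.- (x ℤ.- 0ℤ) ≡ ℤ.- x
  minus = solve-∀
fanCoeff-2-2∷ (suc r) W = minus (fanCoeff (suc r) 2 W)
  where
  minus : ∀ x → (0ℤ ℤ.- 0ℤ) ℤ.- (x ℤ.- 0ℤ) ≡ ℤ.- x
  minus = solve-∀

fanCoeff-1-2∷ : ∀ r W → fanCoeff r 1 (2 ∷ W) ≡ unlessZero r (fanCoeff (pred r) 2 W) ℤ.+ fanCoeff r 1 W
fanCoeff-1-2∷ zero    W = plus (fanCoeff 0 1 W)
  where
  plus : ∀ x → 0ℤ ℤ.- (0ℤ ℤ.- x) ≡ 0ℤ ℤ.+ x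
  plus = solve-∀
fanCoeff-1-2∷ (suc r) W = plus (fanCoeff r 2 W) (fanCoeff (suc r) 1 W)
  where
  plus : ∀ x y → (x ℤ.- 0ℤ) ℤ.- (0ℤ ℤ.- y) ≡ x ℤ.+ y
  plus = solve-∀

2∷2∷-≈₁₂ : ∀ Y → (2 ∷ 2 ∷ Y) ≈₁₂ Y
2∷2∷-≈₁₂ Y .fanCoeff-1-≡ r = begin
    fanCoeff r 1 (2 ∷ 2 ∷ Y)
      ≡⟨ fanCoeff-1-2∷ r (2 ∷ Y) ⟩
    unlessZero r (fanCoeff (pred r) 2 (2 ∷ Y)) ℤ.+ fanCoeff r 1 (2 ∷ Y)
      ≡⟨ cong₂ ℤ._+_ (cong (unlessZero r) (fanCoeff-2-2∷ (pred r) Y)) (fanCoeff-1-2∷ r Y) ⟩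
    unlessZero r (ℤ.- fanCoeff (pred r) 2 Y) ℤ.+ (unlessZero r (fanCoeff (pred r) 2 Y) ℤ.+ fanCoeff r 1 Y)
      ≡⟨ cancel r _ _ ⟩
    fanCoeff r 1 Y ∎
  where
  open ≡-Reasoning
  cancel : ∀ r x y → unlessZero r (ℤ.- x) ℤ.+ (unlessZero r x ℤ.+ y) ≡ y
  cancel zero    x y = trans (ℤ.+-identityˡ _) (ℤ.+-identityˡ y)
  cancel (suc r) x y = neg-cancel x y
    where
    neg-cancel : ∀ x y → ℤ.- x ℤ.+ (x ℤ.+ y) ≡ y
    neg-cancel = solve-∀
2∷2∷-≈₁₂ Y .fanCoeff-2-≡ r =
  trans (fanCoeff-2-2∷ r (2 ∷ Y)) (trans (cong ℤ.-_ (fanCoeff-2-2∷ r Y)) (ℤ.neg-involutive _))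

replicate-2*suc : ∀ {A : Set} a (x : A) → List.replicate (2 * suc a) x ≡ x ∷ x ∷ List.replicate (2 * a) x
replicate-2*suc a x = cong (λ k → List.replicate k x) (ℕ.*-suc 2 a)

replicate-≈₁₂ : ∀ a X → (List.replicate (2 * a) 2 ++ X) ≈₁₂ X
replicate-≈₁₂ zero    X = ≈⇒≈₁₂ ≈-refl
replicate-≈₁₂ (suc a) X =
  subst (λ L → (L ++ X) ≈₁₂ X) (sym (replicate-2*suc a 2))
        (≈₁₂-trans (2∷2∷-≈₁₂ (List.replicate (2 * a) 2 ++ X)) (replicate-≈₁₂ a X))

2∷replicate-≈ : ∀ a {X Y} → X ≈ Y → (2 ∷ List.replicate (2 * a) 2 ++ X) ≈ (2 ∷ Y)
2∷replicate-≈ a {X} X≈Y = 2∷-≈ (≈₁₂-trans (replicate-≈₁₂ a X) (≈⇒≈₁₂ X≈Y))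

fanCoeff-even : ∀ a b → fanCoeff 4 0 (List.replicate (2 * a) 2 ++ 1 ∷ List.replicate (suc (2 * b)) 2 ++ [ 0 ]) ≡ 1ℤ
fanCoeff-even zero    b = fanCoeff-≡ (∷-≈ 1 (2∷replicate-≈ b (≈-refl {[ 0 ]}))) 4 0
fanCoeff-even (suc a) b =
  subst (λ L → fanCoeff 4 0 (L ++ 1 ∷ List.replicate (suc (2 * b)) 2 ++ [ 0 ]) ≡ 1ℤ) (sym (replicate-2*suc a 2))
        (fanCoeff-≡ (∷-≈ 2 (2∷replicate-≈ a (∷-≈ 1 (2∷replicate-≈ b (≈-refl {[ 0 ]}))))) 4 0)

fanCoeff-odd : ∀ a b → fanCoeff 4 0 (List.replicate (suc (2 * a)) 2 ++ 1 ∷ List.replicate (2 * b) 2 ++ [ 0 ]) ≡ ℤ.- 1ℤ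
fanCoeff-odd a zero    = fanCoeff-≡ (2∷replicate-≈ a (≈-refl {1 ∷ [ 0 ]})) 4 0
fanCoeff-odd a (suc b) =
  subst (λ L → fanCoeff 4 0 (List.replicate (suc (2 * a)) 2 ++ 1 ∷ L ++ [ 0 ]) ≡ ℤ.- 1ℤ) (sym (replicate-2*suc b 2))
        (fanCoeff-≡ (2∷replicate-≈ a (∷-≈ 1 (∷-≈ 2 (2∷replicate-≈ b (≈-refl {[ 0 ]}))))) 4 0)

coeff-graphPoly-fan : ∀ {m} (G : Graph (2 + m)) → OuterplanarNearTriangulation G →
  (∀ x y → toℕ x ≡ 0 → toℕ y ≢ 0 → adj G x y ≡ true) →
  ∀ M → coeff (graphPoly G) M ≡ fanCoeff (expOf M 0) (expOf M 1) (map (expOf M) (interval 2 m))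
coeff-graphPoly-fan {m} G ont hub M = begin
  coeff (graphPoly G) M
    ≡⟨ cong (λ p → coeff p M) (graphPoly-diffProduct G) ⟩
  coeff (diffProduct (edgeList G)) M
    ≡⟨ coeff-diffProduct (edgeList G) M ⟩
  diffCoeff (2 + m) (map toℕ² (edgeList G)) (expOf M)
    ≡⟨ cong (λ es → diffCoeff (2 + m) es (expOf M)) edges ⟩
  diffCoeff (2 + m) (spokes 1 m ++ rim 1 m) (expOf M)
    ≡⟨ diffCoeff-↭ (2 + m) (spokes++rim↭fanOrder 1 m) (expOf M) ⟩
  diffCoeff (2 + m) (fanOrder 1 m) (expOf M)
    ≡⟨ diffCoeff-fanOrder (2 + m) 1 m (expOf M) ≤-refl (λ i 1≤i i<1 → ⊥-elim (ℕ.<⇒≱ i<1 1≤i))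
                          (cong suc (ℕ.+-comm 1 m)) ⟩
  fanCoeff (expOf M 0) (expOf M 1) (map (expOf M) (interval 2 m)) ∎
  where
  open ≡-Reasoning
  edges : map toℕ² (edgeList G) ≡ spokes 1 m ++ rim 1 m
  edges = trans (edgeList-pairsWhere G fanEdgeᵇ (fan-adj G ont hub)) (pairsWhere-fan m)

lemmaExp-two : ∀ k p i → 2 ≤ i → i ≢ p → i ≢ 2 * k → lemmaExp k p i ≡ 2
lemmaExp-two k p (suc (suc i)) (s≤s (s≤s _)) i≢p i≢2k rewrite ≢⇒≡ᵇ-false i≢2k | ≢⇒≡ᵇ-false i≢p = refl

lemmaExp-one : ∀ k p → 2 ≤ p → p ≢ 2 * k → lemmaExp k p p ≡ 1
lemmaExp-one k (suc (suc p)) (s≤s (s≤s _)) p≢2k rewrite ≢⇒≡ᵇ-false p≢2k | ≡⇒≡ᵇ-true {p} refl = refl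

lemmaExp-zero : ∀ k p i → 2 ≤ i → i ≡ 2 * k → lemmaExp k p i ≡ 0
lemmaExp-zero k p (suc (suc i)) (s≤s (s≤s _)) i≡2k rewrite ≡⇒≡ᵇ-true i≡2k = refl

lemmaExp-list : ∀ k p m₁ m₂ → p ≡ 2 + m₁ → 2 * k ≡ 3 + (m₁ + m₂) →
  map (lemmaExp k p) (interval 2 (pred (2 * k))) ≡ List.replicate m₁ 2 ++ 1 ∷ List.replicate m₂ 2 ++ [ 0 ]
lemmaExp-list k p m₁ m₂ refl 2k≡ = begin
  map f (interval 2 (pred (2 * k)))
    ≡⟨ cong (λ t → map f (interval 2 t)) length ⟩
  map f (interval 2 (m₁ + suc (m₂ + 1)))
    ≡⟨ trans (cong (map f) (interval-++ 2 m₁ (suc (m₂ + 1)))) (map-++ f (interval 2 m₁) _) ⟩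
  map f (interval 2 m₁) ++ f p ∷ map f (interval (suc p) (m₂ + 1))
    ≡⟨ cong (λ L → map f (interval 2 m₁) ++ f p ∷ L)
            (trans (cong (map f) (interval-++ (suc p) m₂ 1)) (map-++ f (interval (suc p) m₂) _)) ⟩
  map f (interval 2 m₁) ++ f p ∷ map f (interval (suc p) m₂) ++ [ f (suc p + m₂) ]
    ≡⟨ cong₂ _++_ (map-interval-const 2 2 m₁ before)
         (cong₂ _∷_ (lemmaExp-one k p (s≤s (s≤s z≤n)) (<⇒≢ p<2k))
           (cong₂ _++_ (map-interval-const 2 (suc p) m₂ after)
                       (cong [_] (lemmaExp-zero k p (suc p + m₂) (s≤s (s≤s z≤n)) (sym 2k≡))))) ⟩
  List.replicate m₁ 2 ++ 1 ∷ List.replicate m₂ 2 ++ [ 0 ] ∎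
  where
  open ≡-Reasoning
  f : ℕ → ℕ
  f = lemmaExp k p
  length : pred (2 * k) ≡ m₁ + suc (m₂ + 1)
  length = trans (cong pred 2k≡) (ℕ-solve m₁ m₂)
    where
    ℕ-solve : ∀ a b → 2 + (a + b) ≡ a + suc (b + 1)
    ℕ-solve = ℕ-solve-∀
  p<2k : p < 2 * k
  p<2k = subst (p <_) (sym 2k≡) (s≤s (s≤s (s≤s (ℕ.m≤m+n m₁ m₂))))
  before : ∀ i → 2 ≤ i → i < 2 + m₁ → f i ≡ 2
  before i 2≤i i<p = lemmaExp-two k p i 2≤i (<⇒≢ i<p) (<⇒≢ (<-trans i<p p<2k))
  after : ∀ i → suc p ≤ i → i < suc p + m₂ → f i ≡ 2
  after i p<i i<2k =
    lemmaExp-two k p i (ℕ.≤-trans (s≤s (s≤s z≤n)) (ℕ.<⇒≤ p<i)) (>⇒≢ p<i) (<⇒≢ (subst (i <_) (sym 2k≡) i<2k))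

coeff-lemmaMono : ∀ k p m₁ m₂ (G : Graph (suc (2 * suc k))) → OuterplanarNearTriangulation G →
  (∀ x y → toℕ x ≡ 0 → toℕ y ≢ 0 → adj G x y ≡ true) → p ≡ 2 + m₁ → 2 * suc k ≡ 3 + (m₁ + m₂) →
  coeff (graphPoly G) (lemmaMono (suc k) p) ≡ fanCoeff 4 0 (List.replicate m₁ 2 ++ 1 ∷ List.replicate m₂ 2 ++ [ 0 ])
coeff-lemmaMono k p m₁ m₂ G ont hub p≡ 2k≡ = begin
  coeff (graphPoly G) M
    ≡⟨ coeff-graphPoly-fan G ont hub M ⟩
  fanCoeff 4 0 (map (expOf M) (interval 2 (pred (2 * suc k))))
    ≡⟨ cong (fanCoeff 4 0) (map-interval-cong 2 (pred (2 * suc k)) (λ i _ i<n → expOf-tabulate _ (lemmaExp (suc k) p) i<n)) ⟩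
  fanCoeff 4 0 (map (lemmaExp (suc k) p) (interval 2 (pred (2 * suc k))))
    ≡⟨ cong (fanCoeff 4 0) (lemmaExp-list (suc k) p m₁ m₂ p≡ 2k≡) ⟩
  fanCoeff 4 0 (List.replicate m₁ 2 ++ 1 ∷ List.replicate m₂ 2 ++ [ 0 ]) ∎
  where
  open ≡-Reasoning
  M : Vec ℕ (suc (2 * suc k))
  M = lemmaMono (suc k) p

lemma4p7 : (k l : ℕ) (G : Graph (suc (2 * k))) →
    OuterplanarNearTriangulation G →
    (∀ x y → toℕ x ≡ 0 → toℕ y ≢ 0 → adj G x y ≡ true) →
    (∀ x → toℕ x ≡ 1 → degree G x ≡ 2) →
    (∀ x → toℕ x ≡ 2 * k → degree G x ≡ 2) →
    1 ≤ l → l < k →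
    Σ ℤ λ η → (∣ η ∣ ≡ 1) ×
      (coeff (graphPoly G) (lemmaMono k (2 * l)) ≡ η) ×
      (coeff (graphPoly G) (lemmaMono k (suc (2 * l))) ≡ - η)
lemma4p7 (suc k) (suc a) G ont hub _ _ _ (s≤s a<k) with ℕ.m≤n⇒∃[o]m+o≡n a<k
... | b , refl = 1ℤ , refl , even , odd
  where
  even : coeff (graphPoly G) (lemmaMono (suc k) (2 * suc a)) ≡ 1ℤ
  even = trans (coeff-lemmaMono k _ (2 * a) (suc (2 * b)) G ont hub (ℕ.*-suc 2 a) (even-size a b)) (fanCoeff-even a b)
    where
    even-size : ∀ a b → 2 * suc (suc (a + b)) ≡ 3 + (2 * a + suc (2 * b))
    even-size = ℕ-solve-∀
  odd : coeff (graphPoly G) (lemmaMono (suc k) (suc (2 * suc a))) ≡ - 1ℤ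
  odd = trans (coeff-lemmaMono k _ (suc (2 * a)) (2 * b) G ont hub (cong suc (ℕ.*-suc 2 a)) (odd-size a b)) (fanCoeff-odd a b)
    where
    odd-size : ∀ a b → 2 * suc (suc (a + b)) ≡ 3 + (suc (2 * a) + 2 * b)
    odd-size = ℕ-solve-∀
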